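{- For every integer $n \ge 1$, the tensor rank of the matrix multiplication tensor $\mathrm{MM}_n$ is at most $n^3 - n + 1$.
   Context: The matrix multiplication tensor $\mathrm{MM}_n \in \mathbb{C}^{n\times n}\otimes\mathbb{C}^{n\times n}\otimes\mathbb{C}^{n\times n}$ is the tensor with components $\mathrm{MM}^{abc}_{def} = \delta^a_e\,\delta^b_f\,\delta^c_d$ (indices ranging over $1,\dots,n$, $\delta$ the Kronecker delta); equivalently it is determined by $\langle \mathrm{MM}_n, A\otimes B\otimes C\rangle = \operatorname{tr}(ABC)$ for $n\times n$ matrices $A,B,C$. A tensor in $V_1\otimes V_2\otimes V_3$ has rank one if it equals $v_1\otimes v_2\otimes v_3$ with $v_i\in V_i$; the tensor rank of a tensor is the smallest number of rank-one tensors summing to it (over $\mathbb{C}$). -}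

module Defs where

open import Level using (Level; _⊔_; suc)
open import Data.Nat using (ℕ; zero; _≥_; _^_; _∸_) renaming (_+_ to _+ℕ_; suc to sucℕ)
open import Data.Fin using (Fin)
open import Data.Product using (_×_; _,_; ∃; Σ-syntax)
open import Data.List using (List; []; _∷_)
open import Relation.Nullary using (¬_; Dec; yes; no)
open import Algebra.Bundles using (CommutativeRing)
import Algebra.Properties.Monoid.Sum as MonoidSum

module RingOps {c ℓ : Level} (R : CommutativeRing c ℓ) where
  open CommutativeRing R

  natToK : ℕ → Carrier
  natToK zero     = 0#
  natToK (sucℕ m) = 1# + natToK m

  -- evaluation of the monic polynomial  a₀ + a₁ x + … + a_{d-1} x^{d-1} + x^d
  -- given by the coefficient list a₀ ∷ … ∷ a_{d-1} ∷ []
  evalMonic : List Carrier → Carrier → Carrier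
  evalMonic []       x = 1#
  evalMonic (a ∷ as) x = a + x * evalMonic as x

-- An algebraically closed field of characteristic zero, given as a commutative
-- ring with extra axioms.  ℂ is not available in the Agda standard library; by
-- completeness of ACF₀ (the statement "rank MMₙ ≤ r" is an existential
-- first-order sentence over ℚ) the bound holds over ℂ iff it holds over every
-- such field.
record ACF0 (c ℓ : Level) : Set (Level.suc (c ⊔ ℓ)) where
  field
    field′ : CommutativeRing c ℓ
  open CommutativeRing field′
  open RingOps field′
  field
    nontrivial   : ¬ (1# ≈ 0#)
    inverses     : ∀ x → ¬ (x ≈ 0#) → ∃ λ y → x * y ≈ 1#
    charZero     : ∀ (m : ℕ) → ¬ (natToK (sucℕ m) ≈ 0#)
    -- every non-constant monic polynomial has a root
    algClosed    : ∀ (a : Carrier) (as : List Carrier) → ∃ λ x → evalMonic (a ∷ as) x ≈ 0#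

module Tensors {c ℓ : Level} (K : CommutativeRing c ℓ) where
  open CommutativeRing K
  open MonoidSum +-monoid using (sum)
  open import Data.Fin using (_≟_)

  -- n × n matrices over K, indexed by pairs (row , column)
  Idx : ℕ → Set
  Idx n = Fin n × Fin n

  -- tensors in (K^{n×n}) ⊗ (K^{n×n}) ⊗ (K^{n×n}) as coefficient functions
  Tensor3 : ℕ → Set c
  Tensor3 n = Idx n → Idx n → Idx n → Carrier

  δ : ∀ {n} → Fin n → Fin n → Carrier
  δ i j with i ≟ j
  ... | yes _ = 1#
  ... | no  _ = 0#

  -- matrix multiplication tensor: ⟨MMₙ , A ⊗ B ⊗ C⟩ = tr(ABC) = Σ A_{ij} B_{jk} C_{ki},
  -- i.e. coefficient at ((i,j),(k,l),(m,p)) is δ_{jk} δ_{lm} δ_{pi}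
  MM : (n : ℕ) → Tensor3 n
  MM n (i , j) (k , l) (m , p) = δ j k * δ l m * δ p i

  rankOne : ∀ {n} → (Idx n → Carrier) → (Idx n → Carrier) → (Idx n → Carrier) → Tensor3 n
  rankOne u v w x y z = u x * v y * w z

  RankAtMost : ∀ {n} → Tensor3 n → ℕ → Set (c ⊔ ℓ)
  RankAtMost {n} T r =
    Σ[ u ∈ (Fin r → Idx n → Carrier) ] Σ[ v ∈ (Fin r → Idx n → Carrier) ] Σ[ w ∈ (Fin r → Idx n → Carrier) ]
      (∀ x y z → T x y z ≈ sum (λ t → rankOne (u t) (v t) (w t) x y z))

module Submission where

open import Algebra.Bundles using (CommutativeRing)
open import Level using (Level)
open import Data.Maybe using (Maybe; just; nothing)
import Data.Nat as ℕ
open ℕ using (ℕ; zero; suc)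
import Data.Nat.Properties as ℕₚ
open import Data.Integer as ℤ using (ℤ; +_; -[1+_]; sign; ∣_∣; _◃_; _⊖_)
import Data.Integer.Properties as ℤₚ
open import Data.Sign as Sign using (Sign)
open import Data.Fin using (Fin; zero; suc; punchIn; _↑ˡ_; _↑ʳ_)
import Data.Fin.Properties as Fin
open import Data.Vec.Functional using (_++_)
open import Data.Vec.Functional.Properties using (lookup-++ˡ; lookup-++ʳ)
open import Data.Product using (_×_; _,_; proj₁; proj₂)
open import Data.Empty using (⊥-elim)
open import Function using (_∘_)
open import Relation.Nullary using (yes; no)
open import Relation.Binary.PropositionalEquality as ≡ using (_≡_)
open import Defs

-- Writing e_ab for the matrix units, MMₙ is the sum of the n³
-- rank-one tensors e_ab ⊗ e_bc ⊗ e_ca.  Fix the index 0 and, for every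
-- q ≠ 0, collect the "block" of terms with index word (0,0,q), (0,q,c) or
-- (q,b,c); these blocks partition all words except (0,0,0), and each block
-- has n² + n + 1 terms.  Seven of them -- the words over {0,q} other than
-- (0,0,0) -- form 2×2 matrix multiplication with one term deleted, which
-- by a Strassen-type identity is a sum of only 6 rank-one tensors.  Hence
-- every block has rank ≤ n² + n, and rank MMₙ ≤ 1 + (n-1)(n² + n) = n³ - n + 1.
--
-- The statement is over an algebraically closed field of
-- characteristic 0, but the construction works over any commutative ring.

-- The canonical ring homomorphism ℤ → R, packaged for the ring solver.
module IntegerCoefficients {c ℓ} (R : CommutativeRing c ℓ) where
  open CommutativeRing R hiding (zero)
  open import Algebra.Properties.Semiring.Mult semiring using (×-homo-+; ×1-homo-*) renaming (_×_ to _·_)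
  open import Algebra.Properties.Ring ring using (-1*x≈-x)
  open import Algebra.Properties.AbelianGroup +-abelianGroup using (⁻¹-∙-comm; ⁻¹-involutive; ε⁻¹≈ε)
  open import Algebra.Solver.Ring.AlmostCommutativeRing
    using (_-Raw-AlmostCommutative⟶_; fromCommutativeRing)
  open import Algebra.Properties.CommutativeSemigroup +-commutativeSemigroup
    using () renaming (interchange to +-interchange)
  open import Algebra.Properties.CommutativeSemigroup *-commutativeSemigroup
    using () renaming (interchange to *-interchange)
  open import Relation.Binary.Reasoning.Setoid setoid

  -- n ↦ n · 1, so that ν (suc n) = 1# + ν n holds by definition
  ν : ℕ → Carrier
  ν n = n · 1#

  ι : ℤ → Carrier
  ι (+ n)    = ν n
  ι -[1+ n ] = - ν (suc n)

  ι-neg : ∀ z → ι (ℤ.- z) ≈ - ι z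
  ι-neg (+ zero)  = sym ε⁻¹≈ε
  ι-neg (+ suc n) = refl
  ι-neg -[1+ n ]  = sym (⁻¹-involutive _)

  ι-⊖ : ∀ m n → ι (m ⊖ n) ≈ ν m - ν n
  ι-⊖ m       zero    = sym (trans (+-congˡ ε⁻¹≈ε) (+-identityʳ _))
  ι-⊖ zero    (suc n) = sym (+-identityˡ _)
  ι-⊖ (suc m) (suc n) = begin
    ι (suc m ⊖ suc n)           ≡⟨ ≡.cong ι (ℤₚ.[1+m]⊖[1+n]≡m⊖n m n) ⟩
    ι (m ⊖ n)                   ≈⟨ ι-⊖ m n ⟩
    ν m - ν n                   ≈⟨ +-identityˡ _ ⟨
    0# + (ν m - ν n)            ≈⟨ +-congʳ (-‿inverseʳ 1#) ⟨
    (1# - 1#) + (ν m - ν n)     ≈⟨ +-interchange _ _ _ _ ⟩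
    (1# + ν m) + (- 1# - ν n)   ≈⟨ +-congˡ (⁻¹-∙-comm _ _) ⟩
    ν (suc m) - ν (suc n)       ∎

  ι-+ : ∀ a b → ι (a ℤ.+ b) ≈ ι a + ι b
  ι-+ (+ m)    (+ n)    = ×-homo-+ 1# m n
  ι-+ (+ m)    -[1+ n ] = ι-⊖ m (suc n)
  ι-+ -[1+ m ] (+ n)    = trans (ι-⊖ n (suc m)) (+-comm _ _)
  ι-+ -[1+ m ] -[1+ n ] = begin
    - ν (suc (suc (m ℕ.+ n)))   ≡⟨ ≡.cong (λ k → - ν (suc k)) (≡.sym (ℕₚ.+-suc m n)) ⟩
    - ν (suc m ℕ.+ suc n)       ≈⟨ -‿cong (×-homo-+ 1# (suc m) (suc n)) ⟩
    - (ν (suc m) + ν (suc n))   ≈⟨ ⁻¹-∙-comm _ _ ⟨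
    - ν (suc m) + - ν (suc n)   ∎

  -- signs, and the decomposition z = sign z ◃ ∣z∣ reduce ι-* to ℕ
  σ : Sign → Carrier
  σ Sign.+ = 1#
  σ Sign.- = - 1#

  σ-* : ∀ s t → σ (s Sign.* t) ≈ σ s * σ t
  σ-* Sign.+ t      = sym (*-identityˡ _)
  σ-* Sign.- Sign.+ = sym (*-identityʳ _)
  σ-* Sign.- Sign.- = sym (trans (-1*x≈-x (- 1#)) (⁻¹-involutive 1#))

  ι-◃ : ∀ s n → ι (s ◃ n) ≈ σ s * ν n
  ι-◃ s      zero    = sym (zeroʳ _)
  ι-◃ Sign.+ (suc n) = sym (*-identityˡ _)
  ι-◃ Sign.- (suc n) = sym (-1*x≈-x _)

  ι-sign : ∀ a → ι a ≈ σ (sign a) * ν ∣ a ∣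
  ι-sign a = trans (reflexive (≡.cong ι (≡.sym (ℤₚ.◃-inverse a)))) (ι-◃ (sign a) ∣ a ∣)

  ι-* : ∀ a b → ι (a ℤ.* b) ≈ ι a * ι b
  ι-* a b = begin
    ι ((sign a Sign.* sign b) ◃ (∣ a ∣ ℕ.* ∣ b ∣))     ≈⟨ ι-◃ (sign a Sign.* sign b) (∣ a ∣ ℕ.* ∣ b ∣) ⟩
    σ (sign a Sign.* sign b) * ν (∣ a ∣ ℕ.* ∣ b ∣)     ≈⟨ *-cong (σ-* (sign a) (sign b)) (×1-homo-* ∣ a ∣ ∣ b ∣) ⟩
    (σ (sign a) * σ (sign b)) * (ν ∣ a ∣ * ν ∣ b ∣)    ≈⟨ *-interchange _ _ _ _ ⟩
    (σ (sign a) * ν ∣ a ∣) * (σ (sign b) * ν ∣ b ∣)    ≈⟨ *-cong (ι-sign a) (ι-sign b) ⟨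
    ι a * ι b                                          ∎

  ι-hom : ℤ.+-*-rawRing -Raw-AlmostCommutative⟶ fromCommutativeRing R
  ι-hom = record
    { ⟦_⟧ = ι ; +-homo = ι-+ ; *-homo = ι-* ; -‿homo = ι-neg
    ; 0-homo = refl ; 1-homo = +-identityʳ 1# }

  ι-≟ : ∀ a b → Maybe (ι a ≈ ι b)
  ι-≟ a b with a ℤ.≟ b
  ... | yes ≡.refl = just refl
  ... | no _       = nothing

  open import Algebra.Solver.Ring ℤ.+-*-rawRing (fromCommutativeRing R) ι-hom ι-≟ public
    using (solve; _:=_; _:+_; _:*_; :-_; _:-_; con)

module Regrouping {c ℓ} (R : CommutativeRing c ℓ) where
  open import Tactic.RingSolver.Core.AlmostCommutativeRing using (AlmostCommutativeRing; fromCommutativeRing)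
  open import Tactic.RingSolver using (solve-∀)

  R′ : AlmostCommutativeRing c ℓ
  R′ = fromCommutativeRing R (λ _ → nothing)
  open AlmostCommutativeRing R′

  regroup : ∀ (z₀ a₁ a₂ a₃ a₄ a₅ a₆ r₁ r₂ r₃ r₄ : Carrier) →
    z₀ + (a₁ + (a₂ + r₄)) + ((a₃ + (a₄ + r₂)) + ((a₅ + (a₆ + r₃)) + r₁))
    ≈ z₀ + a₁ + a₂ + a₃ + a₄ + a₅ + a₆ + (r₁ + r₂ + r₃ + r₄)
  regroup = solve-∀ R′

module Counting where
  open import Data.Nat using (_+_; _*_; _^_; _∸_)
  open import Data.Nat.Tactic.RingSolver using (solve-∀)
  open ≡.≡-Reasoning

  block-count : ∀ m → 6 + (m * (suc (suc m) * 1) + m * 1 + m * 1 + m * 1) ≡ suc (suc m) * suc (suc (suc m))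
  block-count = solve-∀

  cube : ∀ n → suc n * (suc n * (suc n * 1)) ≡ suc n + n * (suc n * suc (suc n))
  cube = solve-∀

  total-count : ∀ n → 1 + n * (suc n * suc (suc n)) ≡ suc n ^ 3 ∸ suc n + 1
  total-count n = begin
    1 + blocks                          ≡⟨ ℕₚ.+-comm 1 blocks ⟩
    blocks + 1                          ≡⟨ ≡.cong (_+ 1) (ℕₚ.m+n∸m≡n (suc n) blocks) ⟨
    suc n + blocks ∸ suc n + 1          ≡⟨ ≡.cong (λ t → t ∸ suc n + 1) (cube n) ⟨
    suc n ^ 3 ∸ suc n + 1               ∎
    where
    blocks : ℕ
    blocks = n * (suc n * suc (suc n))

module MatrixMultiplication {c ℓ} (R : CommutativeRing c ℓ) where
  open CommutativeRing R hiding (zero)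
  open Tensors R
  open IntegerCoefficients R using (solve; _:=_; _:+_; _:*_; :-_; _:-_; con)
  open Regrouping R using (regroup)
  open Counting using (block-count)
  open import Algebra.Properties.Monoid.Sum +-monoid using (sum; sum-cong-≋; sum-cong-≗; sum-replicate-zero)
  open import Algebra.Properties.CommutativeMonoid.Sum +-commutativeMonoid using (sum-remove; ∑-distrib-+)
  open import Relation.Binary.Reasoning.Setoid setoid

  private variable
    n k r s : ℕ

  sum-↑ : ∀ m (f : Fin (m ℕ.+ k) → Carrier) →
          sum f ≈ sum (λ i → f (i ↑ˡ k)) + sum (λ j → f (m ↑ʳ j))
  sum-↑ zero    f = sym (+-identityˡ _)
  sum-↑ (suc m) f = trans (+-congˡ (sum-↑ m (f ∘ suc))) (sym (+-assoc _ _ _))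

  infix  4 _≋_
  infixl 6 _⊕_

  _≋_ : Tensor3 n → Tensor3 n → Set ℓ
  S ≋ T = ∀ x y z → S x y z ≈ T x y z

  _⊕_ : Tensor3 n → Tensor3 n → Tensor3 n
  (S ⊕ T) x y z = S x y z + T x y z

  ∑ᵀ : (Fin k → Tensor3 n) → Tensor3 n
  ∑ᵀ T x y z = sum (λ i → T i x y z)

  rank-cong : {S T : Tensor3 n} → S ≋ T → RankAtMost S r → RankAtMost T r
  rank-cong S≋T (u , v , w , S≈) = u , v , w , λ x y z → trans (sym (S≋T x y z)) (S≈ x y z)

  rank-rankOne : (u v w : Idx n → Carrier) → RankAtMost (rankOne u v w) 1
  rank-rankOne u v w = (λ _ → u) , (λ _ → v) , (λ _ → w) , λ x y z → sym (+-identityʳ _)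

  rank-⊕ : {S T : Tensor3 n} → RankAtMost S r → RankAtMost T s → RankAtMost (S ⊕ T) (r ℕ.+ s)
  rank-⊕ {r = r} {s = s} {S = S} {T = T} (u₁ , v₁ , w₁ , S≈) (u₂ , v₂ , w₂ , T≈) =
    u₁ ++ u₂ , v₁ ++ v₂ , w₁ ++ w₂ , concatenated
    where
    concatenated : ∀ x y z →
      (S ⊕ T) x y z ≈ sum (λ t → rankOne ((u₁ ++ u₂) t) ((v₁ ++ v₂) t) ((w₁ ++ w₂) t) x y z)
    concatenated x y z = begin
      S x y z + T x y z                    ≈⟨ +-cong (S≈ x y z) (T≈ x y z) ⟩
      sum term₁ + sum term₂                ≡⟨ ≡.cong₂ _+_ (sum-cong-≗ left) (sum-cong-≗ right) ⟨
      sum (term ∘ (_↑ˡ s)) + sum (term ∘ (r ↑ʳ_))  ≈⟨ sum-↑ r term ⟨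
      sum term                             ∎
      where
      term : Fin (r ℕ.+ s) → Carrier
      term t = rankOne ((u₁ ++ u₂) t) ((v₁ ++ v₂) t) ((w₁ ++ w₂) t) x y z
      term₁ : Fin r → Carrier
      term₁ i = rankOne (u₁ i) (v₁ i) (w₁ i) x y z
      term₂ : Fin s → Carrier
      term₂ j = rankOne (u₂ j) (v₂ j) (w₂ j) x y z
      left : ∀ i → term (i ↑ˡ s) ≡ term₁ i
      left i rewrite lookup-++ˡ u₁ u₂ i | lookup-++ˡ v₁ v₂ i | lookup-++ˡ w₁ w₂ i = ≡.refl
      right : ∀ j → term (r ↑ʳ j) ≡ term₂ j
      right j rewrite lookup-++ʳ u₁ u₂ j | lookup-++ʳ v₁ v₂ j | lookup-++ʳ w₁ w₂ j = ≡.refl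

  rank-∑ : {T : Fin k → Tensor3 n} → (∀ i → RankAtMost (T i) r) → RankAtMost (∑ᵀ T) (k ℕ.* r)
  rank-∑ {k = zero}  _    = (λ ()) , (λ ()) , (λ ()) , λ x y z → refl
  rank-∑ {k = suc k} rank = rank-⊕ (rank zero) (rank-∑ (rank ∘ suc))

  δ-resp : {i j : Fin n} {i′ j′ : Fin k} →
           (i ≡ j → i′ ≡ j′) → (i′ ≡ j′ → i ≡ j) → δ i j ≈ δ i′ j′
  δ-resp {i = i} {j} {i′} {j′} to from with i Fin.≟ j | i′ Fin.≟ j′
  ... | yes _  | yes _   = refl
  ... | yes eq | no  neq = ⊥-elim (neq (to eq))
  ... | no neq | yes eq  = ⊥-elim (neq (from eq))
  ... | no _   | no _    = refl

  δ-suc : (a b : Fin n) → δ (suc a) (suc b) ≈ δ a b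
  δ-suc a b = δ-resp {i = suc a} {suc b} {a} {b} Fin.suc-injective (≡.cong suc)

  δ-sym : (a b : Fin n) → δ a b ≈ δ b a
  δ-sym a b = δ-resp {i = a} {b} {b} {a} ≡.sym ≡.sym

  δ-sum : (l : Fin n) (f : Fin n → Carrier) → sum (λ t → δ t l * f t) ≈ f l
  δ-sum {suc n} zero f = begin
    1# * f zero + sum (λ t → 0# * f (suc t))  ≈⟨ +-cong (*-identityˡ _) (sum-cong-≋ (λ t → zeroˡ (f (suc t)))) ⟩
    f zero + sum {n} (λ _ → 0#)               ≈⟨ +-congˡ (sum-replicate-zero n) ⟩
    f zero + 0#                               ≈⟨ +-identityʳ _ ⟩
    f zero                                    ∎
  δ-sum {suc n} (suc l) f = begin
    0# * f zero + sum (λ t → δ (suc t) (suc l) * f (suc t))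
      ≈⟨ +-cong (zeroˡ _) (sum-cong-≋ (λ t → *-congʳ (δ-suc t l))) ⟩
    0# + sum (λ t → δ t l * f (suc t))  ≈⟨ +-identityˡ _ ⟩
    sum (λ t → δ t l * f (suc t))       ≈⟨ δ-sum l (f ∘ suc) ⟩
    f (suc l)                           ∎

  e : Fin n → Fin n → Idx n → Carrier
  e a b x = δ a (proj₁ x) * δ b (proj₂ x)

  cyclic : Fin n → Fin n → Fin n → Tensor3 n
  cyclic a b c = rankOne (e a b) (e b c) (e c a)

  rank-cyclic : (a b c : Fin n) → RankAtMost (cyclic a b c) 1
  rank-cyclic a b c = rank-rankOne (e a b) (e b c) (e c a)

  -- MMₙ = ∑_{a,b,c} e_ab ⊗ e_bc ⊗ e_ca: each sum collapses one pair of deltas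
  cyclic-sum≋MM : ∑ᵀ (λ a → ∑ᵀ (λ b → ∑ᵀ (cyclic a b))) ≋ MM n
  cyclic-sum≋MM (i , j) (k , l) (m , p) = begin
    sum (λ a → sum (λ b → sum (λ c → ((δ a i * δ b j) * (δ b k * δ c l)) * (δ c m * δ a p))))
      ≈⟨ sum-cong-≋ (λ a → sum-cong-≋ (λ b → trans
           (sum-cong-≋ (λ c → collect-c (δ a i) (δ b j) (δ b k) (δ c l) (δ c m) (δ a p)))
           (δ-sum l (λ c → δ c m * (δ a i * δ b j * δ b k * δ a p))))) ⟩
    sum (λ a → sum (λ b → δ l m * (δ a i * δ b j * δ b k * δ a p)))
      ≈⟨ sum-cong-≋ (λ a → trans
           (sum-cong-≋ (λ b → collect-b (δ l m) (δ a i) (δ b j) (δ b k) (δ a p)))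
           (δ-sum j (λ b → δ b k * (δ l m * (δ a i * δ a p))))) ⟩
    sum (λ a → δ j k * (δ l m * (δ a i * δ a p)))
      ≈⟨ trans (sum-cong-≋ (λ a → collect-a (δ j k) (δ l m) (δ a i) (δ a p)))
               (δ-sum i (λ a → δ a p * (δ j k * δ l m))) ⟩
    δ i p * (δ j k * δ l m)  ≈⟨ *-comm _ _ ⟩
    δ j k * δ l m * δ i p    ≈⟨ *-congˡ (δ-sym i p) ⟩
    δ j k * δ l m * δ p i    ∎
    where
    collect-c : ∀ ai bj bk cl cm ap → ((ai * bj) * (bk * cl)) * (cm * ap) ≈ cl * (cm * (ai * bj * bk * ap))
    collect-c = solve 6 (λ ai bj bk cl cm ap →
      ((ai :* bj) :* (bk :* cl)) :* (cm :* ap) := cl :* (cm :* (ai :* bj :* bk :* ap))) refl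
    collect-b : ∀ lm ai bj bk ap → lm * (ai * bj * bk * ap) ≈ bj * (bk * (lm * (ai * ap)))
    collect-b = solve 5 (λ lm ai bj bk ap →
      lm :* (ai :* bj :* bk :* ap) := bj :* (bk :* (lm :* (ai :* ap)))) refl
    collect-a : ∀ jk lm ai ap → jk * (lm * (ai * ap)) ≈ ai * (ap * (jk * lm))
    collect-a = solve 4 (λ jk lm ai ap → jk :* (lm :* (ai :* ap)) := ai :* (ap :* (jk :* lm))) refl

  -- The seven terms of 2×2 matrix multiplication on the indices {o, q}
  -- other than e_oo ⊗ e_oo ⊗ e_oo.
  corner : Fin n → Fin n → Tensor3 n
  corner o q = cyclic o o q ⊕ cyclic o q o ⊕ cyclic o q q
             ⊕ cyclic q o o ⊕ cyclic q o q ⊕ cyclic q q o ⊕ cyclic q q q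

  -- A Strassen-type polynomial identity expressing the seven products as
  -- six.  Writing x = (i , j), y = (k , l), z = (m , p), the variable i0
  -- stands for δ o i and i1 for δ q i, and likewise for j, k, l, m, p.
  strassen-identity : ∀ i0 i1 j0 j1 k0 k1 l0 l1 m0 m1 p0 p1 →
    (i0 * j1 - i1 * j0 + i1 * j1) * (k0 * l1 + k1 * l0 + k1 * l1) * (m0 * p1 + m1 * p0 - m1 * p1)
      + ((i0 * j1) * (k1 * l0) * (m0 * p0 - m0 * p1 - m1 * p0 + m1 * p1)
      + ((- (i0 * j0) + i0 * j1 - i1 * j0 + i1 * j1) * (- (k0 * l1)) * (m1 * p0)
      + ((i0 * j1 + i1 * j1) * (k0 * l1 + k1 * l1) * (- (m0 * p1) + m1 * p1)
      + ((i1 * j0 - i1 * j1) * (k1 * l0 + k1 * l1) * (m1 * p0 - m1 * p1)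
      + ((i1 * j0) * (k0 * l0 + k0 * l1 + k1 * l0 + k1 * l1) * (m0 * p1)
      + 0#)))))
    ≈ (i0 * j0) * (k0 * l1) * (m1 * p0) + (i0 * j1) * (k1 * l0) * (m0 * p0)
      + (i0 * j1) * (k1 * l1) * (m1 * p0) + (i1 * j0) * (k0 * l0) * (m0 * p1)
      + (i1 * j0) * (k0 * l1) * (m1 * p1) + (i1 * j1) * (k1 * l0) * (m0 * p1)
      + (i1 * j1) * (k1 * l1) * (m1 * p1)
  strassen-identity = solve 12 (λ i0 i1 j0 j1 k0 k1 l0 l1 m0 m1 p0 p1 →
    (i0 :* j1 :- i1 :* j0 :+ i1 :* j1) :* (k0 :* l1 :+ k1 :* l0 :+ k1 :* l1) :* (m0 :* p1 :+ m1 :* p0 :- m1 :* p1)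
      :+ ((i0 :* j1) :* (k1 :* l0) :* (m0 :* p0 :- m0 :* p1 :- m1 :* p0 :+ m1 :* p1)
      :+ ((:- (i0 :* j0) :+ i0 :* j1 :- i1 :* j0 :+ i1 :* j1) :* (:- (k0 :* l1)) :* (m1 :* p0)
      :+ ((i0 :* j1 :+ i1 :* j1) :* (k0 :* l1 :+ k1 :* l1) :* (:- (m0 :* p1) :+ m1 :* p1)
      :+ ((i1 :* j0 :- i1 :* j1) :* (k1 :* l0 :+ k1 :* l1) :* (m1 :* p0 :- m1 :* p1)
      :+ ((i1 :* j0) :* (k0 :* l0 :+ k0 :* l1 :+ k1 :* l0 :+ k1 :* l1) :* (m0 :* p1)
      :+ con (+ 0))))))
    := (i0 :* j0) :* (k0 :* l1) :* (m1 :* p0) :+ (i0 :* j1) :* (k1 :* l0) :* (m0 :* p0)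
      :+ (i0 :* j1) :* (k1 :* l1) :* (m1 :* p0) :+ (i1 :* j0) :* (k0 :* l0) :* (m0 :* p1)
      :+ (i1 :* j0) :* (k0 :* l1) :* (m1 :* p1) :+ (i1 :* j1) :* (k1 :* l0) :* (m0 :* p1)
      :+ (i1 :* j1) :* (k1 :* l1) :* (m1 :* p1)) refl

  strassen-terms : Fin n → Fin n → Fin 6 → (Idx n → Carrier) × (Idx n → Carrier) × (Idx n → Carrier)
  strassen-terms o q zero =
    (λ x → e o q x - e q o x + e q q x) , (λ y → e o q y + e q o y + e q q y) , (λ z → e o q z + e q o z - e q q z)
  strassen-terms o q (suc zero) =
    e o q , e q o , (λ z → e o o z - e o q z - e q o z + e q q z)
  strassen-terms o q (suc (suc zero)) =
    (λ x → - e o o x + e o q x - e q o x + e q q x) , (λ y → - e o q y) , e q o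
  strassen-terms o q (suc (suc (suc zero))) =
    (λ x → e o q x + e q q x) , (λ y → e o q y + e q q y) , (λ z → - e o q z + e q q z)
  strassen-terms o q (suc (suc (suc (suc zero)))) =
    (λ x → e q o x - e q q x) , (λ y → e q o y + e q q y) , (λ z → e q o z - e q q z)
  strassen-terms o q (suc (suc (suc (suc (suc zero))))) =
    e q o , (λ y → e o o y + e o q y + e q o y + e q q y) , e o q

  corner-rank : (o q : Fin n) → RankAtMost (corner o q) 6
  corner-rank {n} o q = proj₁ ∘ terms , proj₁ ∘ proj₂ ∘ terms , proj₂ ∘ proj₂ ∘ terms , λ x y z →
    sym (strassen-identity (δ o (proj₁ x)) (δ q (proj₁ x)) (δ o (proj₂ x)) (δ q (proj₂ x))
                           (δ o (proj₁ y)) (δ q (proj₁ y)) (δ o (proj₂ y)) (δ q (proj₂ y))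
                           (δ o (proj₁ z)) (δ q (proj₁ z)) (δ o (proj₂ z)) (δ q (proj₂ z)))
    where
    terms : Fin 6 → (Idx n → Carrier) × (Idx n → Carrier) × (Idx n → Carrier)
    terms = strassen-terms o q

  -- For o ≠ q, the block of o and q consists of the terms with index word
  -- (o,o,q), (o,q,c) or (q,b,c).  With o = 0, the blocks of q = 1, …, n-1
  -- partition all index words except (0,0,0).
  block : Fin n → Fin n → Tensor3 n
  block o q = cyclic o o q ⊕ ∑ᵀ (cyclic o q) ⊕ ∑ᵀ (λ b → ∑ᵀ (cyclic q b))

  blocks≋cyclic-sum : cyclic zero zero zero ⊕ ∑ᵀ (λ q → block zero (suc q))
                    ≋ ∑ᵀ (λ a → ∑ᵀ (λ b → ∑ᵀ (cyclic {suc n} a b)))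
  blocks≋cyclic-sum {n} x y z = begin
    C₀ + sum (λ q → Z q + Y q + X q)      ≈⟨ +-congˡ (∑-distrib-+ (λ q → Z q + Y q) X) ⟩
    C₀ + (sum (λ q → Z q + Y q) + sum X)  ≈⟨ +-congˡ (+-congʳ (∑-distrib-+ Z Y)) ⟩
    C₀ + (sum Z + sum Y + sum X)          ≈⟨ +-assoc _ _ _ ⟨
    C₀ + (sum Z + sum Y) + sum X          ≈⟨ +-congʳ (+-assoc _ _ _) ⟨
    C₀ + sum Z + sum Y + sum X            ∎
    where
    C₀ : Carrier
    C₀ = cyclic zero zero zero x y z
    Z Y X : Fin n → Carrier
    Z q = cyclic zero zero (suc q) x y z
    Y q = sum (λ c → cyclic zero (suc q) c x y z)
    X q = sum (λ b → sum (λ c → cyclic (suc q) b c x y z))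

  module _ {m : ℕ} (q′ : Fin (suc m)) where
    o q : Fin (suc (suc m))
    o = zero
    q = suc q′

    others : Fin m → Fin (suc (suc m))
    others s = suc (punchIn q′ s)

    sum-split : (f : Fin (suc (suc m)) → Carrier) → sum f ≈ f o + (f q + sum (f ∘ others))
    sum-split f = +-congˡ (sum-remove {i = q′} (f ∘ suc))

    block-rest : Tensor3 (suc (suc m))
    block-rest = ∑ᵀ (λ s → ∑ᵀ (cyclic q (others s))) ⊕ ∑ᵀ (λ s → cyclic q o (others s))
               ⊕ ∑ᵀ (λ s → cyclic q q (others s)) ⊕ ∑ᵀ (λ s → cyclic o q (others s))

    block-split : corner o q ⊕ block-rest ≋ block o q
    block-split x y z = sym (begin
      Z + Y + X
        ≈⟨ +-cong (+-congˡ (split (cyclic o q))) (trans (split (λ b → ∑ᵀ (cyclic q b)))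
                  (+-cong (split (cyclic q o)) (+-congʳ (split (cyclic q q))))) ⟩
      Z + (t o q o + (t o q q + r₄)) + ((t q o o + (t q o q + r₂)) + ((t q q o + (t q q q + r₃)) + r₁))
        ≈⟨ regroup _ _ _ _ _ _ _ _ _ _ _ ⟩
      corner o q x y z + block-rest x y z ∎)
      where
      t : Fin (suc (suc m)) → Fin (suc (suc m)) → Fin (suc (suc m)) → Carrier
      t a b c = cyclic a b c x y z
      split : (T : Fin (suc (suc m)) → Tensor3 (suc (suc m))) →
              sum (λ c → T c x y z) ≈ T o x y z + (T q x y z + sum (λ s → T (others s) x y z))
      split T = sum-split (λ c → T c x y z)
      Z Y X r₁ r₂ r₃ r₄ : Carrier
      Z = t o o q
      Y = sum (t o q)
      X = sum (λ b → sum (t q b))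
      r₁ = sum (λ s → sum (t q (others s)))
      r₂ = sum (λ s → t q o (others s))
      r₃ = sum (λ s → t q q (others s))
      r₄ = sum (λ s → t o q (others s))

    -- each block has rank ≤ n² + n: six terms for the corner, one per remaining term
    block-rank : RankAtMost (block o q) (suc (suc m) ℕ.* suc (suc (suc m)))
    block-rank = ≡.subst (RankAtMost (block o q)) (block-count m)
      (rank-cong block-split (rank-⊕ (corner-rank o q) rest-rank))
      where
      rest-rank : RankAtMost block-rest (m ℕ.* (suc (suc m) ℕ.* 1) ℕ.+ m ℕ.* 1 ℕ.+ m ℕ.* 1 ℕ.+ m ℕ.* 1)
      rest-rank = rank-⊕ (rank-⊕ (rank-⊕ (rank-∑ (λ s → rank-∑ (rank-cyclic q (others s))))
                                         (rank-∑ (λ s → rank-cyclic q o (others s))))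
                                 (rank-∑ (λ s → rank-cyclic q q (others s))))
                         (rank-∑ (λ s → rank-cyclic o q (others s)))

  -- the blocks of the indices q ≠ 0 (there are none when n = 1)
  blocks-rank : (q : Fin n) → RankAtMost (block zero (suc q)) (suc n ℕ.* suc (suc n))
  blocks-rank {suc m} = block-rank

  MM-rank : ∀ n → RankAtMost (MM (suc n)) (1 ℕ.+ n ℕ.* (suc n ℕ.* suc (suc n)))
  MM-rank n = rank-cong (λ x y z → trans (blocks≋cyclic-sum x y z) (cyclic-sum≋MM x y z))
                        (rank-⊕ (rank-cyclic zero zero zero) (rank-∑ blocks-rank))

open import Data.Nat using (_≥_; _^_; _∸_; _+_)

corollary2 : ∀ {c ℓ : Level} (K : ACF0 c ℓ) (n : ℕ) → n ≥ 1 →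
    Tensors.RankAtMost (ACF0.field′ K) (Tensors.MM (ACF0.field′ K) n) (n ^ 3 ∸ n + 1)
corollary2 K (suc n) _ =
  ≡.subst (Tensors.RankAtMost (ACF0.field′ K) (Tensors.MM (ACF0.field′ K) (suc n)))
          (Counting.total-count n)
          (MatrixMultiplication.MM-rank (ACF0.field′ K) n)
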